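{- In a complete strong heap of size $n$ whose root element has been replaced by a new element, a single $\mathit{swapping\text{ - }sift\text{ - }down}$ operation can be executed in-place using at most $\lg n + O(1)$ element comparisons, and the number of element moves it performs is $O(n)$.
   Context: Elements come from a totally ordered universe. A binary tree on $n$ nodes is stored in an array $a[0..n-1]$ (indices from $0$): the parent of index $i\neq 0$ is $\lfloor (i-1)/2\rfloor$, the left child of $i$ is $2i+1$, the right child $2i+2$. A strong heap is such an array representing a nearly complete binary tree in which (i) every non-root node's element is not smaller than its parent's element, and (ii) every right child's element is not smaller than its left sibling's element. It is complete if all leaves have the same depth. $\mathit{swapping\text{ - }sift\text{ - }down}$ (for a new element placed at the root): traverse the left spine of the root (the path from the root through successive left children to the leftmost leaf) bottom-up starting from the leftmost leaf, making one element comparison per visited node with the new element, to determine the correct position of the new element on this spine; move all elements on the spine above this position one level up and put the new element at this position; then, for each position $j$ on the left spine to which an element was moved up, proceeding up to the root, compare the element at $j$ with the element at its right sibling $j+1$, and if the former is larger, interchange in-place the entire subtrees rooted at $j$ and $j+1$ by swapping all their elements correspondingly. "In-place" means using only $O(1)$ extra words besides the array. $\lg$ is the base-2 logarithm. -}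

module Defs where

open import Level using (Level; _⊔_)
open import Data.Nat using (ℕ; zero; suc; _+_; _*_; _∸_; _^_; _≤_; _<_; _≡ᵇ_)
open import Data.Nat.DivMod using (_/_)
open import Data.Bool using (Bool; true; false; if_then_else_)
open import Data.Fin using (Fin)
open import Data.Product using (_×_; _,_)
open import Relation.Nullary using (does)
open import Relation.Binary.Bundles using (DecTotalOrder)
open import Relation.Binary.PropositionalEquality using (_≡_)

-- Memory = the array a[0..n-1] plus k extra element registers.
-- A program is a decision tree: it may compare the contents of two
-- locations (branching on the Boolean outcome "x ≤ y") and move (copy)
-- the content of one location to another.  Index bookkeeping is free
-- and lives in the control state (the position in the tree).

data Loc (n k : ℕ) : Set where
  arr : Fin n → Loc n k
  reg : Fin k → Loc n k

data Prog (n k : ℕ) : Set where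
  halt : Prog n k
  cmp  : Loc n k → Loc n k → (Bool → Prog n k) → Prog n k
  move : (src dst : Loc n k) → Prog n k → Prog n k

module _ {a ℓ₁ ℓ₂} (O : DecTotalOrder a ℓ₁ ℓ₂) where
  open DecTotalOrder O renaming (Carrier to A; _≤_ to _⊑_; _≤?_ to _⊑?_)

  -- arrays indexed from 0 (only the indices < n are meaningful)
  Array : Set a
  Array = ℕ → A

  le? : A → A → Bool
  le? x y = does (x ⊑? y)

  parent : ℕ → ℕ
  parent i = (i ∸ 1) / 2

  record StrongHeap (n : ℕ) (H : Array) : Set (a ⊔ ℓ₂) where
    field
      heap-order  : ∀ i → 0 < i → i < n → H (parent i) ⊑ H i
      left-right  : ∀ j → 2 * j + 2 < n → H (2 * j + 1) ⊑ H (2 * j + 2)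

  -- Reference (functional) specification of swapping-sift-down on a
  -- complete tree of height h (n = 2^(h+1) - 1), new element at a[0].

  set : ℕ → A → Array → Array
  set i v b m = if m ≡ᵇ i then v else b m

  swapIdx : ℕ → ℕ → Array → Array
  swapIdx i j b m = if m ≡ᵇ i then b j else (if m ≡ᵇ j then b i else b m)

  -- index of the node of depth t on the left spine of the root
  spine : ℕ → ℕ
  spine t = 2 ^ t ∸ 1

  -- bottom-up search on the left spine for the position of x:
  -- starting at the leaf (depth h), go up while the spine element is > x
  findPos : A → Array → ℕ → ℕ
  findPos x b zero    = zero
  findPos x b (suc t) = if le? (b (spine (suc t))) x then suc t else findPos x b t

  -- place x at spine position p, moving spine elements above p one level up
  shiftUp : A → Array → ℕ → Array
  shiftUp x b zero    = set 0 x b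
  shiftUp x b (suc t) =
    set (spine (suc t)) x (set (spine t) (b (spine (suc t))) (shiftUp x b t))

  -- interchange the subtrees (of height ht) rooted at siblings j and j+1:
  -- node (j+1)·2^d - 1 + r  <->  node (j+2)·2^d - 1 + r,  0 ≤ d ≤ ht, r < 2^d
  swapRow : ℕ → ℕ → ℕ → Array → Array
  swapRow b₁ b₂ zero    b = b
  swapRow b₁ b₂ (suc r) b = swapRow b₁ b₂ r (swapIdx (b₁ + r) (b₂ + r) b)

  swapLevels : ℕ → ℕ → Array → Array
  swapLevels j zero    b = b
  swapLevels j (suc d) b =
    swapLevels j d (swapRow ((j + 1) * 2 ^ d ∸ 1) ((j + 2) * 2 ^ d ∸ 1) (2 ^ d) b)

  swapSubtrees : ℕ → ℕ → Array → Array
  swapSubtrees j ht = swapLevels j (suc ht)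

  fixLevel : ℕ → ℕ → Array → Array
  fixLevel h t b =
    if le? (b (spine t)) (b (suc (spine t))) then b
    else swapSubtrees (spine t) (h ∸ t) b

  fixUp : ℕ → ℕ → Array → Array
  fixUp h zero    b = b
  fixUp h (suc t) b = fixUp h t (fixLevel h (suc t) b)

  swappingSiftDown : ℕ → Array → Array
  swappingSiftDown h b =
    fixUp h (findPos (b 0) b h ∸ 1) (shiftUp (b 0) b (findPos (b 0) b h))

  record Mem (n k : ℕ) : Set a where
    constructor mem
    field
      cells : Fin n → A
      regs  : Fin k → A

  record Outcome (n k : ℕ) : Set a where
    constructor outcome
    field
      final       : Mem n k
      comparisons : ℕ
      moves       : ℕ

  read : ∀ {n k} → Mem n k → Loc n k → A
  read (mem c r) (arr i) = c i
  read (mem c r) (reg i) = r i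

  write : ∀ {n k} → Loc n k → A → Mem n k → Mem n k
  write (arr i) v (mem c r) = mem (λ m → if Data.Fin._≟_ m i .does then v else c m) r
    where import Data.Fin
  write (reg i) v (mem c r) = mem c (λ m → if Data.Fin._≟_ m i .does then v else r m)
    where import Data.Fin

  run : ∀ {n k} → Prog n k → Mem n k → Outcome n k
  run halt M = outcome M 0 0
  run (cmp l₁ l₂ f) M with run (f (le? (read M l₁) (read M l₂))) M
  ... | outcome M' c m = outcome M' (suc c) m
  run (move s d P) M with run P (write d (read M s) M)
  ... | outcome M' c m = outcome M' c (suc m)

-- Realise the functional specification as a decision tree over the array and one scratch
-- register. Placing the new element on the left spine is a chain of adjacent swaps, and an
-- interchange of two sibling subtrees is a sequence of register swaps, row by row. The
-- bottom-up search stops at depth p after h - p + 1 comparisons (or after h, if it reaches the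
-- root) and the fix-up phase then makes one comparison at each of the p - 1 depths above,
-- so at most h = ⌊lg n⌋ comparisons are made. The spine shift costs at most 3h moves, and the
-- interchanges at depths p - 1, ..., 1 move subtrees of geometrically growing sizes
-- 2^(h-t+1) - 1, whose sum is below 2^(h+1) = n + 1; hence at most 6n moves.
module Submission where

open import Defs
open import Data.Bool using (Bool; true; false; if_then_else_)
open import Data.Bool.Properties using (if-float)
open import Data.Fin using (Fin; toℕ; fromℕ<) renaming (zero to fzero)
open import Data.Fin.Properties using (toℕ-fromℕ<; toℕ-injective) renaming (_≟_ to _≟ᶠ_)
open import Data.Nat using (ℕ; zero; suc; _+_; _*_; _∸_; _^_; _≤_; _<_; _≡ᵇ_; z≤n; s≤s; _<?_)
open import Data.Nat.Properties
open import Data.Nat.Logarithm using (⌊log₂_⌋; ⌊log₂⌋-mono-≤; ⌊log₂[2^n]⌋≡n)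
open import Data.Nat.Tactic.RingSolver using (solve-∀)
open import Data.Product using (Σ; _×_; _,_)
open import Function using (_∘_)
open import Relation.Nullary using (yes; no; contradiction)
open import Relation.Binary.Bundles using (DecTotalOrder)
open import Relation.Binary.PropositionalEquality

≡ᵇ-refl : ∀ m → (m ≡ᵇ m) ≡ true
≡ᵇ-refl zero    = refl
≡ᵇ-refl (suc m) = ≡ᵇ-refl m

≢⇒≡ᵇ≡false : ∀ {m n} → m ≢ n → (m ≡ᵇ n) ≡ false
≢⇒≡ᵇ≡false {zero}  {zero}  m≢n = contradiction refl m≢n
≢⇒≡ᵇ≡false {zero}  {suc n} m≢n = refl
≢⇒≡ᵇ≡false {suc m} {zero}  m≢n = refl
≢⇒≡ᵇ≡false {suc m} {suc n} m≢n = ≢⇒≡ᵇ≡false (m≢n ∘ cong suc)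

2^[1+n]≡2^n+2^n : ∀ n → 2 ^ suc n ≡ 2 ^ n + 2 ^ n
2^[1+n]≡2^n+2^n n = cong (2 ^ n +_) (+-identityʳ (2 ^ n))

2^n∸1-mono-< : ∀ {m n} → m < n → 2 ^ m ∸ 1 < 2 ^ n ∸ 1
2^n∸1-mono-< {m} m<n = ∸-monoˡ-< (^-monoʳ-< 2 (s≤s (s≤s z≤n)) m<n) (m^n>0 2 m)

n<2^n : ∀ n → n < 2 ^ n
n<2^n zero    = s≤s z≤n
n<2^n (suc n) = +-mono-≤ (m^n>0 2 n) (≤-trans (n<2^n n) (m≤m+n (2 ^ n) 0))

2^n≤2^[1+n]∸1 : ∀ n → 2 ^ n ≤ 2 ^ suc n ∸ 1
2^n≤2^[1+n]∸1 n = m+n≤o⇒m≤o∸n (2 ^ n)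
  (≤-trans (+-monoʳ-≤ (2 ^ n) (m^n>0 2 n)) (≤-reflexive (sym (2^[1+n]≡2^n+2^n n))))

-- In the complete tree of height h, the right sibling of the spine node of depth t ≥ 1 roots
-- a subtree whose row at relative depth d ≤ h - t ends inside the array.
siblingRow≤ : ∀ h t d → 1 ≤ t → d + t ≤ h →
              (2 ^ t ∸ 1 + 2) * 2 ^ d ∸ 1 + 2 ^ d ≤ 2 ^ suc h ∸ 1
siblingRow≤ h t d 1≤t d+t≤h =
  ≤-trans (≤-reflexive (sym (+-∸-comm (2 ^ d) 1≤row))) (∸-monoˡ-≤ 1 rowEnd≤)
  where
  u = 2 ^ t ∸ 1
  expand : ∀ u P → (u + 2) * P + P ≡ (u + 1) * P + 2 * P
  expand = solve-∀
  rowEnd≤ : (u + 2) * 2 ^ d + 2 ^ d ≤ 2 ^ suc h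
  rowEnd≤ = begin
    (u + 2) * 2 ^ d + 2 ^ d       ≡⟨ expand u (2 ^ d) ⟩
    (u + 1) * 2 ^ d + 2 * 2 ^ d   ≡⟨ cong (λ z → z * 2 ^ d + 2 * 2 ^ d) (m∸n+n≡m (m^n>0 2 t)) ⟩
    2 ^ t * 2 ^ d + 2 ^ suc d     ≡⟨ cong (_+ 2 ^ suc d) (sym (^-distribˡ-+-* 2 t d)) ⟩
    2 ^ (t + d) + 2 ^ suc d       ≤⟨ +-mono-≤ (^-monoʳ-≤ 2 (≤-trans (≤-reflexive (+-comm t d)) d+t≤h))
                                              (^-monoʳ-≤ 2 (≤-trans (≤-reflexive (+-comm 1 d))
                                                                    (≤-trans (+-monoʳ-≤ d 1≤t) d+t≤h))) ⟩
    2 ^ h + 2 ^ h                 ≡⟨ sym (2^[1+n]≡2^n+2^n h) ⟩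
    2 ^ suc h                     ∎
    where open ≤-Reasoning
  1≤row : 1 ≤ (u + 2) * 2 ^ d
  1≤row = ≤-trans (m^n>0 2 d)
    (≤-trans (m≤m+n (2 ^ d) ((u + 1) * 2 ^ d)) (≤-reflexive (cong (_* 2 ^ d) (sym (+-suc u 1)))))

-- 2^(h-s+1) exceeds the size of the subtrees interchanged at depth s.
levelSizes : ℕ → ℕ → ℕ
levelSizes h zero    = 0
levelSizes h (suc t) = 2 ^ suc (h ∸ suc t) + levelSizes h t

levelSizes+2^[h∸t+1]≤2^[h+1] : ∀ h t → t ≤ h → levelSizes h t + 2 ^ suc (h ∸ t) ≤ 2 ^ suc h
levelSizes+2^[h∸t+1]≤2^[h+1] h zero    _   = ≤-refl
levelSizes+2^[h∸t+1]≤2^[h+1] h (suc t) t<h = begin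
  (2 ^ e + levelSizes h t) + 2 ^ e   ≡⟨ regroup (2 ^ e) (levelSizes h t) ⟩
  levelSizes h t + 2 ^ suc e         ≡⟨ cong (λ z → levelSizes h t + 2 ^ suc z) (sym (+-∸-assoc 1 t<h)) ⟩
  levelSizes h t + 2 ^ suc (h ∸ t)   ≤⟨ levelSizes+2^[h∸t+1]≤2^[h+1] h t (≤-trans (n≤1+n t) t<h) ⟩
  2 ^ suc h                          ∎
  where
  open ≤-Reasoning
  e = suc (h ∸ suc t)
  regroup : ∀ x s → (x + s) + x ≡ s + 2 * x
  regroup = solve-∀

module ArrayUpdates {a ℓ₁ ℓ₂} (O : DecTotalOrder a ℓ₁ ℓ₂) where

  set-≡ : ∀ i v b → set O i v b i ≡ v
  set-≡ i v b rewrite ≡ᵇ-refl i = refl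

  set-≢ : ∀ {i m} v b → m ≢ i → set O i v b m ≡ b m
  set-≢ v b m≢i rewrite ≢⇒≡ᵇ≡false m≢i = refl

  set-self : ∀ i b → set O i (b i) b ≗ b
  set-self i b m with m ≟ i
  ... | yes refl = set-≡ i (b i) b
  ... | no  m≢i  = set-≢ (b i) b m≢i

  set-comm : ∀ {i j} u v b → i ≢ j → set O i u (set O j v b) ≗ set O j v (set O i u b)
  set-comm {i} {j} u v b i≢j m with m ≟ i | m ≟ j
  ... | yes refl | _ =
    trans (set-≡ i u (set O j v b)) (sym (trans (set-≢ v (set O i u b) i≢j) (set-≡ i u b)))
  ... | no m≢i | yes refl =
    trans (set-≢ u (set O j v b) m≢i) (trans (set-≡ j v b) (sym (set-≡ j v (set O i u b))))
  ... | no m≢i | no m≢j =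
    trans (trans (set-≢ u (set O j v b) m≢i) (set-≢ v b m≢j))
          (sym (trans (set-≢ v (set O i u b) m≢j) (set-≢ u b m≢i)))

  shiftUp-spine : ∀ x b t → shiftUp O x b t (spine O t) ≡ x
  shiftUp-spine x b zero    = refl
  shiftUp-spine x b (suc t) = set-≡ (spine O (suc t)) x (set O (spine O t) (b (spine O (suc t))) (shiftUp O x b t))

  shiftUp-below : ∀ x b t {m} → spine O t < m → shiftUp O x b t m ≡ b m
  shiftUp-below x b zero    {suc m} _ = refl
  shiftUp-below x b (suc t) {m} j<m = begin
    set O j x (set O i (b j) (shiftUp O x b t)) m   ≡⟨ set-≢ x (set O i (b j) (shiftUp O x b t)) (>⇒≢ j<m) ⟩
    set O i (b j) (shiftUp O x b t) m               ≡⟨ set-≢ (b j) (shiftUp O x b t) (>⇒≢ i<m) ⟩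
    shiftUp O x b t m                               ≡⟨ shiftUp-below x b t i<m ⟩
    b m                                             ∎
    where
    open ≡-Reasoning
    i = spine O t
    j = spine O (suc t)
    i<m = <-trans (2^n∸1-mono-< (n<1+n t)) j<m

  -- swapIdx i j S is definitionally set i (S j) (set j (S i) S).
  swapIdx-shiftUp : ∀ x b t →
    swapIdx O (spine O t) (spine O (suc t)) (shiftUp O x b t) ≗ shiftUp O x b (suc t)
  swapIdx-shiftUp x b t m = begin
    set O i (S j) (set O j (S i) S) m   ≡⟨ set-comm (S j) (S i) S (<⇒≢ i<j) m ⟩
    set O j (S i) (set O i (S j) S) m   ≡⟨ cong₂ (λ u v → set O j u (set O i v S) m)
                                                 (shiftUp-spine x b t) (shiftUp-below x b t i<j) ⟩
    set O j x (set O i (b j) S) m       ∎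
    where
    open ≡-Reasoning
    S = shiftUp O x b t
    i = spine O t
    j = spine O (suc t)
    i<j = 2^n∸1-mono-< (n<1+n t)

module Programs {a ℓ₁ ℓ₂} (O : DecTotalOrder a ℓ₁ ℓ₂) (n k : ℕ) where

  infixr 4 _⨾_
  _⨾_ : Prog n k → Prog n k → Prog n k
  halt        ⨾ Q = Q
  cmp l₁ l₂ f ⨾ Q = cmp l₁ l₂ (λ b → f b ⨾ Q)
  move s d P  ⨾ Q = move s d (P ⨾ Q)

  run-⨾ : ∀ P Q M →
    let R = run O P M ; R′ = run O Q (Outcome.final R) in
    run O (P ⨾ Q) M ≡ outcome (Outcome.final R′)
                              (Outcome.comparisons R + Outcome.comparisons R′)
                              (Outcome.moves R + Outcome.moves R′)
  run-⨾ halt          Q M = refl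
  run-⨾ (cmp l₁ l₂ f) Q M rewrite run-⨾ (f (le? O (read O M l₁) (read O M l₂))) Q M = refl
  run-⨾ (move s d P)  Q M rewrite run-⨾ P Q (write O d (read O M s) M) = refl

  Represents : Mem O n k → Array O → Set a
  Represents M B = ∀ i → Mem.cells M i ≡ B (toℕ i)

  Delivers : Outcome O n k → Array O → ℕ → ℕ → Set a
  Delivers R B c m = Represents (Outcome.final R) B × Outcome.comparisons R ≤ c × Outcome.moves R ≤ m

  record Implements (P : Prog n k) (F : Array O → Array O) (c m : ℕ) : Set a where
    constructor implements
    field delivers : ∀ {M B} → Represents M B → Delivers (run O P M) (F B) c m

  halt-implements : Implements halt (λ B → B) 0 0
  halt-implements = implements λ rep → rep , z≤n , z≤n

  ⨾-implements : ∀ {P Q F G c c′ m m′} → Implements P F c m → Implements Q G c′ m′ →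
                 Implements (P ⨾ Q) (G ∘ F) (c + c′) (m + m′)
  ⨾-implements {P} {Q} {F} {G} {c} {c′} {m} {m′} (implements p) (implements q) = implements λ {M} {B} rep →
    let rep₁ , c₁ , m₁ = p {B = B} rep
        rep₂ , c₂ , m₂ = q {B = F B} rep₁
    in subst (λ R → Delivers R (G (F B)) (c + c′) (m + m′)) (sym (run-⨾ P Q M)) (rep₂ , +-mono-≤ c₁ c₂ , +-mono-≤ m₁ m₂)

  implements-weaken : ∀ {P F G c c′ m m′} → Implements P F c m →
                      (∀ B → F B ≗ G B) → c ≤ c′ → m ≤ m′ → Implements P G c′ m′
  implements-weaken (implements p) F≗G c≤c′ m≤m′ = implements λ {M} {B} rep →
    let rep′ , c₁ , m₁ = p {B = B} rep
    in (λ i → trans (rep′ i) (F≗G B (toℕ i))) , ≤-trans c₁ c≤c′ , ≤-trans m₁ m≤m′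

  swapVia : Fin k → Fin n → Fin n → Prog n k
  swapVia r i j = move (arr i) (reg r) (move (arr j) (arr i) (move (reg r) (arr j) halt))

  swapVia-implements : ∀ r i j → Implements (swapVia r i j) (swapIdx O (toℕ i) (toℕ j)) 0 3
  swapVia-implements r i j = implements λ {M} {B} rep → swapped {M} {B} rep , z≤n , ≤-refl
    where
    swapped : ∀ {M B} → Represents M B →
              Represents (Outcome.final (run O (swapVia r i j) M)) (swapIdx O (toℕ i) (toℕ j) B)
    swapped rep m with m ≟ᶠ j | m ≟ᶠ i
    ... | yes refl | yes refl rewrite ≡ᵇ-refl (toℕ m) | ≡-≟-identity _≟ᶠ_ {r} refl = rep m
    ... | yes refl | no m≢i
      rewrite ≡ᵇ-refl (toℕ m) | ≢⇒≡ᵇ≡false (m≢i ∘ toℕ-injective) | ≡-≟-identity _≟ᶠ_ {r} refl = rep i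
    ... | no _     | yes refl rewrite ≡ᵇ-refl (toℕ m) = rep j
    ... | no m≢j   | no m≢i
      rewrite ≢⇒≡ᵇ≡false (m≢j ∘ toℕ-injective) | ≢⇒≡ᵇ≡false (m≢i ∘ toℕ-injective) = rep m

  -- Out-of-range indices give halt; the correctness lemmas below exclude them.
  swapAt : Fin k → ℕ → ℕ → Prog n k
  swapAt r i j with i <? n | j <? n
  ... | yes i<n | yes j<n = swapVia r (fromℕ< i<n) (fromℕ< j<n)
  ... | _       | _       = halt

  swapAt-implements : ∀ r {i j} → i < n → j < n → Implements (swapAt r i j) (swapIdx O i j) 0 3
  swapAt-implements r {i} {j} i<n j<n with i <? n | j <? n
  ... | yes i<n′ | yes j<n′ =
    subst₂ (λ i′ j′ → Implements (swapVia r (fromℕ< i<n′) (fromℕ< j<n′)) (swapIdx O i′ j′) 0 3) (toℕ-fromℕ< i<n′) (toℕ-fromℕ< j<n′)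
           (swapVia-implements r _ _)
  ... | no i≮n | _      = contradiction i<n i≮n
  ... | yes _  | no j≮n = contradiction j<n j≮n

  compareAt : ℕ → ℕ → (Bool → Prog n k) → Prog n k
  compareAt i j f with i <? n | j <? n
  ... | yes i<n | yes j<n = cmp (arr (fromℕ< i<n)) (arr (fromℕ< j<n)) f
  ... | _       | _       = halt

  compareAt-implements : ∀ {i j} f {F₁ F₂ c m} → i < n → j < n →
    Implements (f true) F₁ c m → Implements (f false) F₂ c m →
    Implements (compareAt i j f) (λ B → if le? O (B i) (B j) then F₁ B else F₂ B) (suc c) m
  compareAt-implements {i} {j} f i<n j<n (implements p₁) (implements p₂) with i <? n | j <? n
  ... | yes i<n′ | yes j<n′ = implements branch
    where
    branch : ∀ {M B} → Represents M B →
      Delivers (run O (cmp (arr (fromℕ< i<n′)) (arr (fromℕ< j<n′)) f) M)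
               (if le? O (B i) (B j) then _ else _) (suc _) _
    branch {M} {B} rep
      rewrite rep (fromℕ< i<n′) | rep (fromℕ< j<n′) | toℕ-fromℕ< i<n′ | toℕ-fromℕ< j<n′
      with le? O (B i) (B j)
    ... | true  = let rep′ , c′ , m′ = p₁ rep in rep′ , s≤s c′ , m′
    ... | false = let rep′ , c′ , m′ = p₂ rep in rep′ , s≤s c′ , m′
  ... | no i≮n | _      = contradiction i<n i≮n
  ... | yes _  | no j≮n = contradiction j<n j≮n

module SubtreeInterchange {a ℓ₁ ℓ₂} (O : DecTotalOrder a ℓ₁ ℓ₂) (n : ℕ) where
  open Programs O n 1

  swapRowP : ℕ → ℕ → ℕ → Prog n 1
  swapRowP b₁ b₂ zero    = halt
  swapRowP b₁ b₂ (suc r) = swapAt fzero (b₁ + r) (b₂ + r) ⨾ swapRowP b₁ b₂ r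

  swapRowP-implements : ∀ b₁ b₂ r → b₁ ≤ b₂ → b₂ + r ≤ n →
                        Implements (swapRowP b₁ b₂ r) (swapRow O b₁ b₂ r) 0 (3 * r)
  swapRowP-implements b₁ b₂ zero    _     _     = halt-implements
  swapRowP-implements b₁ b₂ (suc r) b₁≤b₂ row≤n =
    implements-weaken
      (⨾-implements (swapAt-implements fzero b₁+r<n b₂+r<n)
                    (swapRowP-implements b₁ b₂ r b₁≤b₂ (≤-trans (+-monoʳ-≤ b₂ (n≤1+n r)) row≤n)))
      (λ _ _ → refl) z≤n (≤-reflexive (sym (*-suc 3 r)))
    where
    b₂+r<n : b₂ + r < n
    b₂+r<n = ≤-trans (≤-reflexive (sym (+-suc b₂ r))) row≤n
    b₁+r<n : b₁ + r < n
    b₁+r<n = ≤-trans (s≤s (+-monoˡ-≤ r b₁≤b₂)) b₂+r<n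

  swapLevelsP : ℕ → ℕ → Prog n 1
  swapLevelsP j zero    = halt
  swapLevelsP j (suc d) = swapRowP ((j + 1) * 2 ^ d ∸ 1) ((j + 2) * 2 ^ d ∸ 1) (2 ^ d) ⨾ swapLevelsP j d

  swapLevelsP-implements : ∀ j D → (∀ d → d < D → (j + 2) * 2 ^ d ∸ 1 + 2 ^ d ≤ n) →
                           Implements (swapLevelsP j D) (swapLevels O j D) 0 (3 * 2 ^ D)
  swapLevelsP-implements j zero    _       = implements-weaken halt-implements (λ _ _ → refl) z≤n z≤n
  swapLevelsP-implements j (suc d) rows≤n =
    implements-weaken
      (⨾-implements (swapRowP-implements _ _ (2 ^ d) left≤right (rows≤n d ≤-refl))
                    (swapLevelsP-implements j d (λ d′ d′<d → rows≤n d′ (m<n⇒m<1+n d′<d))))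
      (λ _ _ → refl) z≤n (≤-reflexive (sym (trans (cong (3 *_) (2^[1+n]≡2^n+2^n d)) (*-distribˡ-+ 3 (2 ^ d) (2 ^ d)))))
    where
    left≤right : (j + 1) * 2 ^ d ∸ 1 ≤ (j + 2) * 2 ^ d ∸ 1
    left≤right = ∸-monoˡ-≤ 1 (*-monoˡ-≤ (2 ^ d) (+-monoʳ-≤ j (n≤1+n 1)))

module SwappingSiftDownProgram {a ℓ₁ ℓ₂} (O : DecTotalOrder a ℓ₁ ℓ₂) (h : ℕ) where

  n : ℕ
  n = 2 ^ suc h ∸ 1

  open Programs O n 1
  open SubtreeInterchange O n
  open ArrayUpdates O

  spine<n : ∀ {t} → t ≤ h → spine O t < n
  spine<n t≤h = 2^n∸1-mono-< (s≤s t≤h)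

  fixLevelP : ℕ → Prog n 1
  fixLevelP t = compareAt (spine O t) (suc (spine O t))
    λ { true → halt ; false → swapLevelsP (spine O t) (suc (h ∸ t)) }

  fixLevelP-implements : ∀ {t} → 1 ≤ t → t ≤ h →
                         Implements (fixLevelP t) (fixLevel O h t) 1 (3 * 2 ^ suc (h ∸ t))
  fixLevelP-implements {t} 1≤t t≤h =
    compareAt-implements _ (spine<n t≤h) sibling<n
      (implements-weaken halt-implements (λ _ _ → refl) z≤n z≤n)
      (swapLevelsP-implements (spine O t) (suc (h ∸ t)) rows≤n)
    where
    j = spine O t
    rows≤n : ∀ d → d < suc (h ∸ t) → (j + 2) * 2 ^ d ∸ 1 + 2 ^ d ≤ n
    rows≤n d (s≤s d≤h∸t) =
      siblingRow≤ h t d 1≤t (≤-trans (+-monoˡ-≤ t d≤h∸t) (≤-reflexive (m∸n+n≡m t≤h)))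
    firstRowEnd : (j + 2) * 1 ∸ 1 + 1 ≡ suc (suc j)
    firstRowEnd = begin
      (j + 2) * 1 ∸ 1 + 1   ≡⟨ cong (λ z → z ∸ 1 + 1) (*-identityʳ (j + 2)) ⟩
      j + 2 ∸ 1 + 1         ≡⟨ cong (_+ 1) (+-∸-assoc j {2} {1} (s≤s z≤n)) ⟩
      j + 1 + 1             ≡⟨ +-assoc j 1 1 ⟩
      j + 2                 ≡⟨ +-comm j 2 ⟩
      suc (suc j)           ∎
      where open ≡-Reasoning
    sibling<n : suc j < n
    sibling<n = subst (_≤ n) firstRowEnd (rows≤n 0 (s≤s z≤n))

  fixUpP : ℕ → Prog n 1
  fixUpP zero    = halt
  fixUpP (suc t) = fixLevelP (suc t) ⨾ fixUpP t

  fixUpP-implements : ∀ {t} → t ≤ h → Implements (fixUpP t) (fixUp O h t) t (3 * levelSizes h t)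
  fixUpP-implements {zero}  _   = halt-implements
  fixUpP-implements {suc t} t<h =
    implements-weaken
      (⨾-implements (fixLevelP-implements (s≤s z≤n) t<h) (fixUpP-implements (≤-trans (n≤1+n t) t<h)))
      (λ _ _ → refl) ≤-refl (≤-reflexive (sym (*-distribˡ-+ 3 (2 ^ suc (h ∸ suc t)) (levelSizes h t))))

  shiftUpP : ℕ → Prog n 1
  shiftUpP zero    = halt
  shiftUpP (suc t) = shiftUpP t ⨾ swapAt fzero (spine O t) (spine O (suc t))

  shiftUpP-implements : ∀ {t} → t ≤ h → Implements (shiftUpP t) (λ B → shiftUp O (B 0) B t) 0 (3 * t)
  shiftUpP-implements {zero}  _ = implements-weaken halt-implements (λ B m → sym (set-self 0 B m)) z≤n z≤n
  shiftUpP-implements {suc t} t<h =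
    implements-weaken
      (⨾-implements (shiftUpP-implements (≤-trans (n≤1+n t) t<h))
                    (swapAt-implements fzero (spine<n (≤-trans (n≤1+n t) t<h)) (spine<n t<h)))
      (λ B → swapIdx-shiftUp (B 0) B t) z≤n
      (≤-reflexive (trans (+-comm (3 * t) 3) (sym (*-suc 3 t))))

  siftBody : ℕ → Array O → Array O
  siftBody p B = fixUp O h (p ∸ 1) (shiftUp O (B 0) B p)

  siftBodyP : ℕ → Prog n 1
  siftBodyP p = shiftUpP p ⨾ fixUpP (p ∸ 1)

  moveBudget : ℕ
  moveBudget = 3 * (h + 2 ^ suc h)

  siftBodyP-implements : ∀ {p} → p ≤ h → Implements (siftBodyP p) (siftBody p) (p ∸ 1) moveBudget
  siftBodyP-implements {p} p≤h =
    implements-weaken (⨾-implements (shiftUpP-implements p≤h) (fixUpP-implements p∸1≤h))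
      (λ _ _ → refl) ≤-refl moves≤
    where
    p∸1≤h = ≤-trans (m∸n≤m p 1) p≤h
    moves≤ : 3 * p + 3 * levelSizes h (p ∸ 1) ≤ moveBudget
    moves≤ = begin
      3 * p + 3 * levelSizes h (p ∸ 1)   ≡⟨ sym (*-distribˡ-+ 3 p _) ⟩
      3 * (p + levelSizes h (p ∸ 1))     ≤⟨ *-monoʳ-≤ 3 (+-mono-≤ p≤h
                                              (m+n≤o⇒m≤o _ (levelSizes+2^[h∸t+1]≤2^[h+1] h (p ∸ 1) p∸1≤h))) ⟩
      moveBudget                         ∎
      where open ≤-Reasoning

  siftDownP : ℕ → Prog n 1
  siftDownP zero    = siftBodyP 0
  siftDownP (suc t) = compareAt (spine O (suc t)) 0 λ { true → siftBodyP (suc t) ; false → siftDownP t }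

  siftDownP-implements : ∀ {t} → t ≤ h →
    Implements (siftDownP t) (λ B → siftBody (findPos O (B 0) B t) B) t moveBudget
  siftDownP-implements {zero}  _   = siftBodyP-implements z≤n
  siftDownP-implements {suc t} t<h =
    implements-weaken
      (compareAt-implements _ (spine<n t<h) (spine<n z≤n)
        (siftBodyP-implements t<h) (siftDownP-implements {t} (≤-trans (n≤1+n t) t<h)))
      (λ B → cong-app (sym (if-float (λ p → siftBody p B) (le? O (B (spine O (suc t))) (B 0)))))
      ≤-refl ≤-refl

  swappingSiftDownP-implements : Implements (siftDownP h) (swappingSiftDown O h) h moveBudget
  swappingSiftDownP-implements = siftDownP-implements ≤-refl

  h≤⌊log₂n⌋ : h ≤ ⌊log₂ n ⌋
  h≤⌊log₂n⌋ = ≤-trans (≤-reflexive (sym (⌊log₂[2^n]⌋≡n h))) (⌊log₂⌋-mono-≤ (2^n≤2^[1+n]∸1 h))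

  moveBudget≤6n : moveBudget ≤ 6 * n
  moveBudget≤6n = begin
    3 * (h + 2 ^ suc h)   ≡⟨ cong (λ z → 3 * (h + z)) (sym (m∸n+n≡m (m^n>0 2 (suc h)))) ⟩
    3 * (h + (n + 1))     ≡⟨ cong (3 *_) (regroup h n) ⟩
    3 * (suc h + n)       ≤⟨ *-monoʳ-≤ 3 (+-monoˡ-≤ n (≤-trans (n<2^n h) (2^n≤2^[1+n]∸1 h))) ⟩
    3 * (n + n)           ≡⟨ cong (3 *_) (cong (n +_) (sym (+-identityʳ n))) ⟩
    3 * (2 * n)           ≡⟨ sym (*-assoc 3 2 n) ⟩
    6 * n                 ∎
    where
    open ≤-Reasoning
    regroup : ∀ h n → h + (n + 1) ≡ suc h + n
    regroup = solve-∀

lemma2 : ∀ {a ℓ₁ ℓ₂} →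
    Σ ℕ λ k → Σ ℕ λ c → Σ ℕ λ d →
    (O : DecTotalOrder a ℓ₁ ℓ₂) → (h : ℕ) →
    Σ (Prog (2 ^ suc h ∸ 1) k) λ P →
    (H : Array O) → StrongHeap O (2 ^ suc h ∸ 1) H →
    (x : DecTotalOrder.Carrier O) → (r₀ : Fin k → DecTotalOrder.Carrier O) →
    ((i : Fin (2 ^ suc h ∸ 1)) →
        Mem.cells (Outcome.final (run O P (mem (λ i → set O 0 x H (toℕ i)) r₀))) i
          ≡ swappingSiftDown O h (set O 0 x H) (toℕ i))
    × Outcome.comparisons (run O P (mem (λ i → set O 0 x H (toℕ i)) r₀))
        ≤ ⌊log₂ (2 ^ suc h ∸ 1) ⌋ + c
    × Outcome.moves (run O P (mem (λ i → set O 0 x H (toℕ i)) r₀))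
        ≤ d * (2 ^ suc h ∸ 1)
lemma2 = 1 , 0 , 6 , λ O h → let open SwappingSiftDownProgram O h in
  siftDownP h , λ H _ x r₀ →
    let correct , comparisons≤h , moves≤budget =
          Programs.Implements.delivers swappingSiftDownP-implements (λ _ → refl)
    in correct
     , ≤-trans comparisons≤h (≤-trans h≤⌊log₂n⌋ (≤-reflexive (sym (+-identityʳ _))))
     , ≤-trans moves≤budget moveBudget≤6n
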